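{- There is a function $C_2(t,\epsilon)$ such that the following holds for all $t\in\mathbb{N}$ and $\epsilon\in(0,1)$: let $G$ be a bipartite graph with parts $A,B$, with minimum degree $\delta(G)\geq C_2(t,\epsilon)$, which is induced $S_{t,t}$-free. Then for every edge $ab$ of $G$ we have $|S_{N(a)}^{N(b)}(\epsilon)|\leq C_2(t,\epsilon)$.
   Context: $S_{t,t}$ is the graph with vertex set $\{x,x_1,\dots,x_t,y,y_1,\dots,y_t\}$ and edge set $\{xy\}\cup\{xy_1,\dots,xy_t\}\cup\{yx_1,\dots,yx_t\}$; induced $S_{t,t}$-free means no induced subgraph isomorphic to $S_{t,t}$. $N(v)$ is the neighbourhood of $v$. For vertex sets $X,Y$ and $\varepsilon\in(0,1)$, $S_X^Y(\varepsilon)=\{x\in X : |N(x)\cap Y|\leq (1-\varepsilon)|Y|\}$.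
   Formalization: The parameter ε ranges over the rationals in (0,1), so the function $C_2(t,\epsilon)$ is defined at rational ε only. -}

module Defs where

import Agda.Primitive
open import Data.Nat using (ℕ; zero; suc; _≤_)
open import Data.Fin using (Fin)
open import Data.Bool using (Bool; true; false; _∧_; not; _≟_)
open import Data.List using (List; length; filter; allFin)
open import Data.Integer using (+_)
open import Data.Rational using (ℚ; _/_; _-_; _*_; 1ℚ) renaming (_≤_ to _≤ℚ_)
import Data.Rational.Properties as ℚP
open import Data.Product using (Σ; _×_; _,_)
open import Function.Definitions using (Injective)
open import Relation.Binary.PropositionalEquality using (_≡_)
open import Relation.Nullary.Decidable using (Dec; does)
open import Relation.Unary using (Pred; Decidable)

record Graph (n : ℕ) : Set where
  field
    adj   : Fin n → Fin n → Bool
    sym   : ∀ u v → adj u v ≡ adj v u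
    irrefl : ∀ v → adj v v ≡ false
open Graph public

ℕ→ℚ : ℕ → ℚ
ℕ→ℚ k = + k / 1

count : ∀ {n} {P : Pred (Fin n) Agda.Primitive.lzero} → Decidable P → ℕ
count {n} P? = length (filter P? (allFin n))

inN : ∀ {n} (G : Graph n) (v w : Fin n) → Set
inN G v w = adj G v w ≡ true

inN? : ∀ {n} (G : Graph n) (v : Fin n) → Decidable (inN G v)
inN? G v w = adj G v w ≟ true

degree : ∀ {n} → Graph n → Fin n → ℕ
degree G v = count (inN? G v)

-- minimum degree δ(G) ≥ C  (vacuous for the empty graph)
minDegree≥ : ∀ {n} → Graph n → ℕ → Set
minDegree≥ G C = ∀ v → C ≤ degree G v

-- G is bipartite with parts A = {v | side v ≡ true}, B = {v | side v ≡ false}: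
-- every edge goes between the two parts.
IsBipartition : ∀ {n} → Graph n → (Fin n → Bool) → Set
IsBipartition {n} G side = ∀ (u v : Fin n) → adj G u v ≡ true → side u ≡ not (side v)

data SVert (t : ℕ) : Set where
  vx vy : SVert t
  vxi vyi : Fin t → SVert t

SAdj : ∀ {t} → SVert t → SVert t → Bool
SAdj vx vy = true
SAdj vy vx = true
SAdj vx (vyi _) = true
SAdj (vyi _) vx = true
SAdj vy (vxi _) = true
SAdj (vxi _) vy = true
SAdj _ _ = false

HasInducedS : ∀ {n} → ℕ → Graph n → Set
HasInducedS {n} t G =
  Σ (SVert t → Fin n) λ f →
    Injective _≡_ _≡_ f × (∀ u v → adj G (f u) (f v) ≡ SAdj u v)

InducedSFree : ∀ {n} → ℕ → Graph n → Set
InducedSFree t G = HasInducedS t G → Data.Empty.⊥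
  where import Data.Empty

commonNbrs : ∀ {n} → Graph n → Fin n → Fin n → ℕ
commonNbrs G x b = count (λ w → Data.Bool.Properties.T? (adj G x w ∧ adj G b w))
  where import Data.Bool.Properties

InS : ∀ {n} → Graph n → ℚ → Fin n → Fin n → Fin n → Set
InS G ε a b x = inN G a x × (ℕ→ℚ (commonNbrs G x b) ≤ℚ ((1ℚ - ε) * ℕ→ℚ (degree G b)))

InS? : ∀ {n} (G : Graph n) (ε : ℚ) (a b : Fin n) → Decidable (InS G ε a b)
InS? G ε a b x = Relation.Nullary.Decidable._×-dec_ (inN? G a x)
  (ℕ→ℚ (commonNbrs G x b) ℚP.≤? ((1ℚ - ε) * ℕ→ℚ (degree G b)))

sizeS : ∀ {n} → Graph n → ℚ → Fin n → Fin n → ℕ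
sizeS G ε a b = count (InS? G ε a b)

-- Let q be the denominator of ε, so ε ≥ 1/q and every vertex of S = S_{N(a)}^{N(b)}(ε) is
-- non-adjacent to at least |N(b)|/q vertices of N(b).  Pick w₁, …, w_t ∈ N(b) greedily: by double
-- counting the non-edges between S and N(b), some w ∈ N(b) is non-adjacent to more than |S|/2q
-- vertices of S; keep only those vertices of S and delete w from N(b).  As |N(b)| ≥ 2qt, the t
-- deletions never push a vertex of S below |N(b)|/2q non-neighbours.  If |S| > (2q)^t t, at least
-- t vertices u₁, …, u_t of S survive, and x = a, y = b, x_i = w_i, y_i = u_i span an induced
-- S_{t,t}, bipartiteness making both sides independent.
module Submission where

open import Data.Bool using (Bool; true; false; _∧_; not; if_then_else_)
open import Data.Bool.Properties using (∧-conicalˡ; ∧-conicalʳ; not-injective; not-¬)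
open import Data.Empty using (⊥-elim)
open import Data.Fin using (Fin; zero; suc; _≟_)
open import Data.Fin.Properties using (any?)
open import Data.Integer as ℤ using (+[1+_]; -[1+_]; +0; +<+)
import Data.Integer.Properties as ℤ
open import Data.List using (length; filter; tabulate)
open import Data.Nat using (ℕ; zero; suc; _+_; _*_; _^_; _≤_; _<_; z≤n; s≤s; NonZero; >-nonZero⁻¹; _<?_)
open import Data.Nat.Coprimality using (Coprime)
import Data.Nat.Properties as ℕ
open import Data.Product using (Σ; ∃; _×_; _,_; proj₁; proj₂)
open import Data.Rational as ℚ using (ℚ; mkℚ; 0ℚ; 1ℚ; ↧ₙ_; *<*)
  renaming (_*_ to _*ℚ_; _≤_ to _≤ℚ_; _<_ to _<ℚ_)
import Data.Rational.Properties as ℚ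
import Data.Rational.Unnormalised as ℚᵘ
import Data.Rational.Unnormalised.Properties as ℚᵘ
open import Data.Vec.Functional using (_∷_)
open import Function using (flip; _∘_)
open import Function.Definitions using (Injective)
open import Level using (0ℓ)
open import Relation.Binary.PropositionalEquality
open import Relation.Nullary using (Dec; does; yes; no; contradiction)
open import Relation.Nullary.Decidable using (_×-dec_; T?)
open import Relation.Unary using (Pred; Decidable)

open import Algebra.Properties.CommutativeSemigroup ℕ.*-commutativeSemigroup using (x∙yz≈y∙xz)
open import Algebra.Properties.Semiring.Sum ℕ.+-*-semiring
  using (sum; sum-syntax; sum-cong-≗; ∑-comm; ∑-distrib-+; *-distribˡ-sum; *-distribʳ-sum)

open import Defs hiding (sym)

private
  variable
    m n k s r : ℕ

χ : Bool → ℕ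
χ true  = 1
χ false = 0

∣_∣ : (Fin n → Bool) → ℕ
∣ P ∣ = ∑[ i < _ ] χ (P i)

_∩_ : (P Q : Fin n → Bool) → Fin n → Bool
(P ∩ Q) i = P i ∧ Q i

∁ : (Fin n → Bool) → Fin n → Bool
∁ P i = not (P i)

-- Defined by if_then_else_ so that (P - suc x) ∘ suc reduces to (P ∘ suc) - x.
_-_ : (Fin n → Bool) → Fin n → Fin n → Bool
(P - x) i = if does (i ≟ x) then false else P i

∣P∣≡1+∣P-x∣ : ∀ (P : Fin n → Bool) {x} → P x ≡ true → ∣ P ∣ ≡ suc ∣ P - x ∣
∣P∣≡1+∣P-x∣ P {zero}  Px = cong (λ c → χ c + ∣ P ∘ suc ∣) Px
∣P∣≡1+∣P-x∣ P {suc x} Px rewrite ∣P∣≡1+∣P-x∣ (P ∘ suc) Px = ℕ.+-suc (χ (P zero)) _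

∣P∩Q∣≡1+∣[P-x]∩Q∣ : ∀ (P Q : Fin n → Bool) {x} → P x ≡ true → Q x ≡ true →
                    ∣ P ∩ Q ∣ ≡ suc ∣ (P - x) ∩ Q ∣
∣P∩Q∣≡1+∣[P-x]∩Q∣ P Q {zero}  Px Qx = cong₂ (λ p q → χ (p ∧ q) + ∣ (P ∘ suc) ∩ (Q ∘ suc) ∣) Px Qx
∣P∩Q∣≡1+∣[P-x]∩Q∣ P Q {suc x} Px Qx rewrite ∣P∩Q∣≡1+∣[P-x]∩Q∣ (P ∘ suc) (Q ∘ suc) Px Qx =
  ℕ.+-suc (χ (P zero ∧ Q zero)) _

∈P-x⇒≢x : ∀ (P : Fin n → Bool) {x} i → (P - x) i ≡ true → i ≢ x
∈P-x⇒≢x P {x} i i∈P-x with i ≟ x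
... | no i≢x = i≢x

P-x⊆P : ∀ (P : Fin n → Bool) {x} i → (P - x) i ≡ true → P i ≡ true
P-x⊆P P {x} i i∈P-x with does (i ≟ x)
... | false = i∈P-x

∃-member : ∀ (P : Fin n → Bool) → 0 < ∣ P ∣ → ∃ λ x → P x ≡ true
∃-member {suc n} P 0<∣P∣ with P zero in P0
... | true  = zero , P0
... | false = let x , Px = ∃-member (P ∘ suc) 0<∣P∣ in suc x , Px

∣Q∩P∣+∣P∩∁Q∣≡∣P∣ : ∀ (P Q : Fin n → Bool) → ∣ Q ∩ P ∣ + ∣ P ∩ ∁ Q ∣ ≡ ∣ P ∣
∣Q∩P∣+∣P∩∁Q∣≡∣P∣ P Q = trans (sym (∑-distrib-+ (λ i → χ (Q i ∧ P i)) (λ i → χ (P i ∧ not (Q i)))))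
                              (sum-cong-≗ λ i → split (P i) (Q i))
  where
  split : ∀ p q → χ (q ∧ p) + χ (p ∧ not q) ≡ χ p
  split false false = refl
  split false true  = refl
  split true  false = refl
  split true  true  = refl

length-filter-tabulate : ∀ {A : Set} {P : Pred A 0ℓ} (P? : Decidable P) (f : Fin n → A) →
                         length (filter P? (tabulate f)) ≡ ∑[ i < n ] χ (does (P? (f i)))
length-filter-tabulate {zero}  P? f = refl
length-filter-tabulate {suc n} P? f with does (P? (f zero))
... | true  = cong suc (length-filter-tabulate P? (f ∘ suc))
... | false = length-filter-tabulate P? (f ∘ suc)

count≡∣does∣ : ∀ {P : Pred (Fin n) 0ℓ} (P? : Decidable P) → count P? ≡ ∣ (λ i → does (P? i)) ∣
count≡∣does∣ P? = length-filter-tabulate P? (λ i → i)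

sum∈ : (Fin n → Bool) → (Fin n → ℕ) → ℕ
sum∈ P f = ∑[ i < _ ] (χ (P i) * f i)

syntax sum∈ P (λ i → x) = ∑[ i ∈ P ] x

∑-mono-≤ : ∀ {f g : Fin n → ℕ} → (∀ i → f i ≤ g i) → sum f ≤ sum g
∑-mono-≤ {zero}  f≤g = z≤n
∑-mono-≤ {suc n} f≤g = ℕ.+-mono-≤ (f≤g zero) (∑-mono-≤ (f≤g ∘ suc))

∑∈-mono-≤ : ∀ (P : Fin n → Bool) {f g : Fin n → ℕ} → (∀ i → P i ≡ true → f i ≤ g i) →
            ∑[ i ∈ P ] f i ≤ ∑[ i ∈ P ] g i
∑∈-mono-≤ P {f} {g} f≤g = ∑-mono-≤ pointwise
  where
  pointwise : ∀ i → χ (P i) * f i ≤ χ (P i) * g i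
  pointwise i with P i in Pi
  ... | false = z≤n
  ... | true  = ℕ.*-monoʳ-≤ 1 (f≤g i Pi)

∑∈-const : ∀ (P : Fin n → Bool) c → ∑[ i ∈ P ] c ≡ ∣ P ∣ * c
∑∈-const P c = sym (*-distribʳ-sum c (χ ∘ P))

*-distribˡ-∑∈ : ∀ (P : Fin n → Bool) c (f : Fin n → ℕ) → c * ∑[ i ∈ P ] f i ≡ ∑[ i ∈ P ] (c * f i)
*-distribˡ-∑∈ P c f = trans (*-distribˡ-sum c (λ i → χ (P i) * f i))
                            (sum-cong-≗ λ i → x∙yz≈y∙xz c (χ (P i)) (f i))

double-counting : ∀ (R : Fin m → Fin k → Bool) S D →
                  ∑[ x ∈ S ] ∣ D ∩ R x ∣ ≡ ∑[ y ∈ D ] ∣ S ∩ flip R y ∣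
double-counting R S D = begin
  ∑[ x ∈ S ] ∣ D ∩ R x ∣
    ≡⟨ sum-cong-≗ (λ x → *-distribˡ-sum (χ (S x)) (λ y → χ (D y ∧ R x y))) ⟩
  ∑[ x < _ ] ∑[ y < _ ] (χ (S x) * χ (D y ∧ R x y))
    ≡⟨ ∑-comm (λ x y → χ (S x) * χ (D y ∧ R x y)) ⟩
  ∑[ y < _ ] ∑[ x < _ ] (χ (S x) * χ (D y ∧ R x y))
    ≡⟨ sum-cong-≗ (λ y → sum-cong-≗ λ x → swap (S x) (D y) (R x y)) ⟩
  ∑[ y < _ ] ∑[ x < _ ] (χ (D y) * χ (S x ∧ R x y))
    ≡⟨ sum-cong-≗ (λ y → *-distribˡ-sum (χ (D y)) (λ x → χ (S x ∧ R x y))) ⟨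
  ∑[ y ∈ D ] ∣ S ∩ flip R y ∣
    ∎
  where
  open ≡-Reasoning
  swap : ∀ s d r → χ s * χ (d ∧ r) ≡ χ d * χ (s ∧ r)
  swap false false r = refl
  swap false true  r = refl
  swap true  false r = refl
  swap true  true  r = refl

dense-rows⇒dense-column : ∀ (R : Fin m → Fin k → Bool) S D Q → 0 < ∣ S ∣ →
                          (∀ x → S x ≡ true → ∣ D ∣ < Q * ∣ D ∩ R x ∣) →
                          ∃ λ y → D y ≡ true × ∣ S ∣ < Q * ∣ S ∩ flip R y ∣
dense-rows⇒dense-column R S D Q 0<∣S∣ dense-rows
  with any? (λ y → (D y Data.Bool.≟ true) ×-dec (∣ S ∣ <? Q * ∣ S ∩ flip R y ∣))
... | yes dense-column = dense-column
... | no ∄dense-column = ⊥-elim (ℕ.<-irrefl refl (begin-strict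
  ∣ S ∣ * suc ∣ D ∣                 ≡⟨ ∑∈-const S (suc ∣ D ∣) ⟨
  ∑[ x ∈ S ] suc ∣ D ∣              ≤⟨ ∑∈-mono-≤ S dense-rows ⟩
  ∑[ x ∈ S ] (Q * ∣ D ∩ R x ∣)      ≡⟨ *-distribˡ-∑∈ S Q (λ x → ∣ D ∩ R x ∣) ⟨
  Q * ∑[ x ∈ S ] ∣ D ∩ R x ∣        ≡⟨ cong (Q *_) (double-counting R S D) ⟩
  Q * ∑[ y ∈ D ] ∣ S ∩ flip R y ∣   ≡⟨ *-distribˡ-∑∈ D Q (λ y → ∣ S ∩ flip R y ∣) ⟩
  ∑[ y ∈ D ] (Q * ∣ S ∩ flip R y ∣) ≤⟨ ∑∈-mono-≤ D sparse-columns ⟩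
  ∑[ y ∈ D ] ∣ S ∣                  ≡⟨ ∑∈-const D ∣ S ∣ ⟩
  ∣ D ∣ * ∣ S ∣                     ≡⟨ ℕ.*-comm ∣ D ∣ ∣ S ∣ ⟩
  ∣ S ∣ * ∣ D ∣                     <⟨ ℕ.m<n+m _ 0<∣S∣ ⟩
  ∣ S ∣ + ∣ S ∣ * ∣ D ∣             ≡⟨ ℕ.*-suc ∣ S ∣ ∣ D ∣ ⟨
  ∣ S ∣ * suc ∣ D ∣                 ∎))
  where
  open ℕ.≤-Reasoning
  sparse-columns : ∀ y → D y ≡ true → Q * ∣ S ∩ flip R y ∣ ≤ ∣ S ∣
  sparse-columns y Dy = ℕ.≮⇒≥ λ dense → ∄dense-column (y , Dy , dense)

record Distinct (P : Fin n → Bool) (s : ℕ) : Set where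
  field
    elem      : Fin s → Fin n
    injective : Injective _≡_ _≡_ elem
    member    : ∀ i → P (elem i) ≡ true

open Distinct

Distinct-⊆ : ∀ {P Q : Fin n → Bool} → (∀ x → P x ≡ true → Q x ≡ true) → Distinct P s → Distinct Q s
Distinct-⊆ P⊆Q xs = record { elem = elem xs ; injective = injective xs ; member = λ i → P⊆Q _ (member xs i) }

[]ᵈ : ∀ {P : Fin n → Bool} → Distinct P 0
[]ᵈ = record { elem = λ () ; injective = λ { {()} } ; member = λ () }

_∷ᵈ_ : ∀ {P : Fin n → Bool} {x} → P x ≡ true → Distinct (P - x) s → Distinct P (suc s)
_∷ᵈ_ {P = P} {x} Px xs = record { elem = x ∷ elem xs ; injective = x∷xs-injective ; member = x∷xs⊆P }
  where
  x≢xs : ∀ i → x ≢ elem xs i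
  x≢xs i = ≢-sym (∈P-x⇒≢x P _ (member xs i))
  x∷xs-injective : Injective _≡_ _≡_ (x ∷ elem xs)
  x∷xs-injective {zero}  {zero}  _ = refl
  x∷xs-injective {zero}  {suc j} e = contradiction e (x≢xs j)
  x∷xs-injective {suc i} {zero}  e = contradiction (sym e) (x≢xs i)
  x∷xs-injective {suc i} {suc j} e = cong suc (injective xs e)
  x∷xs⊆P : ∀ i → P ((x ∷ elem xs) i) ≡ true
  x∷xs⊆P zero    = Px
  x∷xs⊆P (suc i) = P-x⊆P P _ (member xs i)

choose : ∀ (P : Fin n → Bool) → s ≤ ∣ P ∣ → Distinct P s
choose {s = zero}  P _ = []ᵈ
choose {s = suc s} P s<∣P∣ =
  let x , Px = ∃-member P (ℕ.<-≤-trans (s≤s z≤n) s<∣P∣)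
  in  Px ∷ᵈ choose (P - x) (ℕ.≤-pred (subst (suc s ≤_) (∣P∣≡1+∣P-x∣ P Px) s<∣P∣))

record Biclique (R : Fin m → Fin k → Bool) (S : Fin m → Bool) (D : Fin k → Bool) (s r : ℕ) : Set where
  field
    left     : Distinct S s
    right    : Distinct D r
    complete : ∀ i j → R (elem left i) (elem right j) ≡ true

open Biclique

extend : ∀ {R : Fin m → Fin k → Bool} {S D y} → D y ≡ true →
         Biclique R (S ∩ flip R y) (D - y) s r → Biclique R S D s (suc r)
extend {R = R} {S} {y = y} Dy B = record
  { left     = Distinct-⊆ (λ x → ∧-conicalˡ (S x) _) (left B)
  ; right    = Dy ∷ᵈ right B
  ; complete = complete′
  }
  where
  complete′ : ∀ i j → R (elem (left B) i) ((y ∷ elem (right B)) j) ≡ true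
  complete′ i zero    = ∧-conicalʳ (S _) _ (member (left B) i)
  complete′ i (suc j) = complete B i j

-- Each round deletes from D one vertex y with R x y for every surviving x, which lowers both
-- sides of the invariant ∣ D ∩ R x ∣ ≥ r + ∣ D ∣ / Q by at least one.
dense⇒biclique : ∀ (R : Fin m → Fin k → Bool) Q .{{_ : NonZero Q}} r S D →
                 (∀ x → S x ≡ true → Q * r + ∣ D ∣ ≤ Q * ∣ D ∩ R x ∣) →
                 Q ^ r * s < ∣ S ∣ → Biclique R S D s r
dense⇒biclique R Q zero S D _ large = record
  { left     = choose S (ℕ.<⇒≤ (subst (_< ∣ S ∣) (ℕ.*-identityˡ _) large))
  ; right    = []ᵈ
  ; complete = λ _ ()
  }
dense⇒biclique {k = k} {s = s} R Q (suc r) S D dense large =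
  extend Dy (dense⇒biclique R Q r (S ∩ flip R y) (D - y) dense′ large′)
  where
  dense-rows : ∀ x → S x ≡ true → ∣ D ∣ < Q * ∣ D ∩ R x ∣
  dense-rows x Sx = ℕ.<-≤-trans (ℕ.m<n+m ∣ D ∣ (>-nonZero⁻¹ (Q * suc r) {{ℕ.m*n≢0 Q (suc r)}})) (dense x Sx)
  column : ∃ λ y → D y ≡ true × ∣ S ∣ < Q * ∣ S ∩ flip R y ∣
  column = dense-rows⇒dense-column R S D Q (ℕ.≤-<-trans z≤n large) dense-rows
  y : Fin k
  y = proj₁ column
  Dy : D y ≡ true
  Dy = proj₁ (proj₂ column)
  large′ : Q ^ r * s < ∣ S ∩ flip R y ∣
  large′ = ℕ.*-cancelˡ-< Q _ _ (begin-strict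
    Q * (Q ^ r * s)       ≡⟨ ℕ.*-assoc Q (Q ^ r) s ⟨
    Q ^ suc r * s         <⟨ large ⟩
    ∣ S ∣                 <⟨ proj₂ (proj₂ column) ⟩
    Q * ∣ S ∩ flip R y ∣  ∎)
    where open ℕ.≤-Reasoning
  dense′ : ∀ x → (S ∩ flip R y) x ≡ true → Q * r + ∣ D - y ∣ ≤ Q * ∣ (D - y) ∩ R x ∣
  dense′ x Sx∧Rxy = ℕ.+-cancelˡ-≤ Q _ _ (begin
    Q + (Q * r + ∣ D - y ∣)          ≤⟨ ℕ.+-monoʳ-≤ Q (ℕ.+-monoʳ-≤ (Q * r) (ℕ.n≤1+n _)) ⟩
    Q + (Q * r + suc ∣ D - y ∣)      ≡⟨ ℕ.+-assoc Q (Q * r) _ ⟨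
    Q + Q * r + suc ∣ D - y ∣        ≡⟨ cong₂ _+_ (ℕ.*-suc Q r) (∣P∣≡1+∣P-x∣ D Dy) ⟨
    Q * suc r + ∣ D ∣                ≤⟨ dense x (∧-conicalˡ (S x) _ Sx∧Rxy) ⟩
    Q * ∣ D ∩ R x ∣                  ≡⟨ cong (Q *_) (∣P∩Q∣≡1+∣[P-x]∩Q∣ D (R x) Dy (∧-conicalʳ (S x) _ Sx∧Rxy)) ⟩
    Q * suc ∣ (D - y) ∩ R x ∣        ≡⟨ ℕ.*-suc Q _ ⟩
    Q + Q * ∣ (D - y) ∩ R x ∣        ∎)
    where open ℕ.≤-Reasoning

module _ {n} (G : Graph n) where

  induced⇒injective : ∀ {t} (f : SVert t → Fin n) → (∀ u v → adj G (f u) (f v) ≡ SAdj u v) →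
                      Injective _≡_ _≡_ (f ∘ vxi) → Injective _≡_ _≡_ (f ∘ vyi) → Injective _≡_ _≡_ f
  induced⇒injective f f-induced xs-injective ys-injective = f-injective
    where
    separated : ∀ {u v} w → SAdj u w ≢ SAdj v w → f u ≡ f v → u ≡ v
    separated {u} {v} w u≁v fu≡fv =
      contradiction (trans (sym (f-induced u w)) (trans (cong (λ z → adj G z (f w)) fu≡fv) (f-induced v w))) u≁v
    f-injective : Injective _≡_ _≡_ f
    f-injective {vx}    {vx}    _ = refl
    f-injective {vx}    {vy}    = separated vx λ ()
    f-injective {vx}    {vxi i} = separated (vyi i) λ ()
    f-injective {vx}    {vyi i} = separated vy λ ()
    f-injective {vy}    {vx}    = separated vx λ ()
    f-injective {vy}    {vy}    _ = refl
    f-injective {vy}    {vxi i} = separated vx λ ()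
    f-injective {vy}    {vyi i} = separated (vxi i) λ ()
    f-injective {vxi i} {vx}    = separated (vyi i) λ ()
    f-injective {vxi i} {vy}    = separated vx λ ()
    f-injective {vxi i} {vxi j} = cong vxi ∘ xs-injective
    f-injective {vxi i} {vyi j} = separated vy λ ()
    f-injective {vyi i} {vx}    = separated vy λ ()
    f-injective {vyi i} {vy}    = separated (vxi i) λ ()
    f-injective {vyi i} {vxi j} = separated vy λ ()
    f-injective {vyi i} {vyi j} = cong vyi ∘ ys-injective

  module _ {side : Fin n → Bool} (bipartite : IsBipartition G side) where

    common-neighbour⇒non-adjacent : ∀ {u v w} → adj G u v ≡ true → adj G u w ≡ true → adj G v w ≡ false
    common-neighbour⇒non-adjacent {u} {v} {w} uv uw with adj G v w in vw
    ... | false = refl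
    ... | true  = contradiction (bipartite v w vw)
                    (not-¬ (not-injective (trans (sym (bipartite u v uv)) (bipartite u w uw))))

    anticomplete⇒inducedS : ∀ {t a b} → adj G a b ≡ true →
                            Biclique (λ x → ∁ (adj G x)) (adj G a) (adj G b) t t → HasInducedS t G
    anticomplete⇒inducedS {t} {a} {b} ab B =
      embed , induced⇒injective embed embed-induced (injective (right B)) (injective (left B)) , embed-induced
      where
      ys : Fin t → Fin n
      ys = elem (left B)
      xs : Fin t → Fin n
      xs = elem (right B)
      embed : SVert t → Fin n
      embed vx      = a
      embed vy      = b
      embed (vxi i) = xs i
      embed (vyi i) = ys i
      ba : adj G b a ≡ true
      ba = trans (Graph.sym G b a) ab
      a∼ys : ∀ i → adj G a (ys i) ≡ true
      a∼ys = member (left B)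
      b∼xs : ∀ i → adj G b (xs i) ≡ true
      b∼xs = member (right B)
      ys≁xs : ∀ i j → adj G (ys i) (xs j) ≡ false
      ys≁xs i j = not-injective (complete B i j)
      embed-induced : ∀ u v → adj G (embed u) (embed v) ≡ SAdj u v
      embed-induced vx      vx      = Graph.irrefl G a
      embed-induced vx      vy      = ab
      embed-induced vx      (vxi i) = common-neighbour⇒non-adjacent ba (b∼xs i)
      embed-induced vx      (vyi i) = a∼ys i
      embed-induced vy      vx      = ba
      embed-induced vy      vy      = Graph.irrefl G b
      embed-induced vy      (vxi i) = b∼xs i
      embed-induced vy      (vyi i) = common-neighbour⇒non-adjacent ab (a∼ys i)
      embed-induced (vxi i) vx      = common-neighbour⇒non-adjacent (b∼xs i) ba
      embed-induced (vxi i) vy      = trans (Graph.sym G _ b) (b∼xs i)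
      embed-induced (vxi i) (vxi j) = common-neighbour⇒non-adjacent (b∼xs i) (b∼xs j)
      embed-induced (vxi i) (vyi j) = trans (Graph.sym G _ _) (ys≁xs j i)
      embed-induced (vyi i) vx      = trans (Graph.sym G _ a) (a∼ys i)
      embed-induced (vyi i) vy      = common-neighbour⇒non-adjacent (a∼ys i) ab
      embed-induced (vyi i) (vxi j) = ys≁xs i j
      embed-induced (vyi i) (vyi j) = common-neighbour⇒non-adjacent (a∼ys i) (a∼ys j)

-- With ε = (1 + p)/q, the hypothesis unfolds in ℚᵘ to c q ≤ (q - (1 + p)) d.
cross-multiply : ∀ c d p q-1 .(cop : Coprime (suc p) (suc q-1)) →
                 ℕ→ℚ c ≤ℚ (1ℚ ℚ.- mkℚ +[1+ p ] q-1 cop) *ℚ ℕ→ℚ d → c * suc q-1 + suc p * d ≤ suc q-1 * d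
cross-multiply c d p q-1 cop c≤[1-ε]d = ℤ.drop‿+≤+ (begin
  + (c * q + P * d)                      ≡⟨ cong₂ ℤ._+_ (ℤ.pos-* c q) (ℤ.pos-* P d) ⟩
  + c ℤ.* + q ℤ.+ + P ℤ.* + d            ≤⟨ ℤ.+-monoˡ-≤ (+ P ℤ.* + d) cq≤[q-P]d ⟩
  (+ q ℤ.- + P) ℤ.* + d ℤ.+ + P ℤ.* + d ≡⟨ cancel (+ q) (+ P) (+ d) ⟩
  + q ℤ.* + d                            ≡⟨ ℤ.pos-* q d ⟨
  + (q * d)                              ∎)
  where
  open import Data.Integer using (+_)
  open import Data.Integer.Tactic.RingSolver using (solve-∀)
  open ℤ.≤-Reasoning
  q = suc q-1
  P = suc p
  ε = mkℚ +[1+ p ] q-1 cop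
  cancel : ∀ Q P D → (Q ℤ.- P) ℤ.* D ℤ.+ P ℤ.* D ≡ Q ℤ.* D
  cancel = solve-∀
  unfold-↥ : ∀ Q P D → (+ 1 ℤ.* Q ℤ.+ ℤ.- P ℤ.* + 1) ℤ.* D ℤ.* + 1 ≡ (Q ℤ.- P) ℤ.* D
  unfold-↥ = solve-∀
  c≤[1-ε]dᵘ : ℚᵘ.mkℚᵘ (+ c) 0 ℚᵘ.≤ (ℚᵘ.1ℚᵘ ℚᵘ.- ℚ.toℚᵘ ε) ℚᵘ.* ℚᵘ.mkℚᵘ (+ d) 0
  c≤[1-ε]dᵘ = ℚᵘ.≤-respˡ-≃ (ℚ.toℚᵘ-fromℚᵘ _) (ℚᵘ.≤-respʳ-≃ toℚᵘ-[1-ε]d (ℚ.toℚᵘ-mono-≤ c≤[1-ε]d))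
    where
    toℚᵘ-[1-ε]d : ℚ.toℚᵘ ((1ℚ ℚ.- ε) *ℚ ℕ→ℚ d) ℚᵘ.≃ (ℚᵘ.1ℚᵘ ℚᵘ.- ℚ.toℚᵘ ε) ℚᵘ.* ℚᵘ.mkℚᵘ (+ d) 0
    toℚᵘ-[1-ε]d = ℚᵘ.≃-trans (ℚ.toℚᵘ-homo-* (1ℚ ℚ.- ε) (ℕ→ℚ d))
      (ℚᵘ.*-cong (ℚᵘ.≃-trans (ℚ.toℚᵘ-homo-+ 1ℚ (ℚ.- ε)) (ℚᵘ.+-congʳ ℚᵘ.1ℚᵘ (ℚ.toℚᵘ-homo‿- ε)))
                 (ℚ.toℚᵘ-fromℚᵘ _))
  cq≤[q-P]d : + c ℤ.* + q ℤ.≤ (+ q ℤ.- + P) ℤ.* + d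
  cq≤[q-P]d = subst₂ ℤ._≤_ (cong (λ k → + c ℤ.* + suc k) (trans (ℕ.*-identityʳ _) (ℕ.+-identityʳ q-1)))
                           (unfold-↥ (+ q) (+ P) (+ d))
                           (ℚᵘ.drop-*≤* c≤[1-ε]dᵘ)

≤[1-ε]*⇒≤↧ε* : ∀ ε {c m} → 0ℚ <ℚ ε → ℕ→ℚ c ≤ℚ (1ℚ ℚ.- ε) *ℚ ℕ→ℚ (c + m) → c + m ≤ ↧ₙ ε * m
≤[1-ε]*⇒≤↧ε* (mkℚ +0 _ _)       (*<* (+<+ ()))
≤[1-ε]*⇒≤↧ε* (mkℚ -[1+ _ ] _ _) (*<* ())
≤[1-ε]*⇒≤↧ε* (mkℚ +[1+ p ] q-1 cop) {c} {m} _ c≤[1-ε]d = ℕ.+-cancelˡ-≤ (q * c) _ _ (begin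
  q * c + (c + m)         ≤⟨ ℕ.+-monoʳ-≤ (q * c) (ℕ.m≤n*m (c + m) (suc p)) ⟩
  q * c + suc p * (c + m) ≡⟨ cong (_+ suc p * (c + m)) (ℕ.*-comm q c) ⟩
  c * q + suc p * (c + m) ≤⟨ cross-multiply c (c + m) p q-1 cop c≤[1-ε]d ⟩
  q * (c + m)             ≡⟨ ℕ.*-distribˡ-+ q c m ⟩
  q * c + q * m           ∎)
  where
  open ℕ.≤-Reasoning
  q = suc q-1

from-does : ∀ {A : Set} (a? : Dec A) → does a? ≡ true → A
from-does (yes a) _ = a

C₂ : ℕ → ℚ → ℕ
C₂ t ε = (2 * ↧ₙ ε) ^ t * t + 2 * ↧ₙ ε * t

size-bound : ∀ {n} (G : Graph n) {side} → IsBipartition G side → ∀ t ε → 0ℚ <ℚ ε →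
             minDegree≥ G (C₂ t ε) → InducedSFree t G → ∀ {a b} → adj G a b ≡ true →
             sizeS G ε a b ≤ C₂ t ε
size-bound {n} G bipartite t ε 0<ε δ≥C₂ S-free {a} {b} ab = ℕ.≮⇒≥ λ C₂<∣S∣ →
  S-free (anticomplete⇒inducedS G bipartite ab (biclique C₂<∣S∣))
  where
  q = ↧ₙ ε
  N = adj G
  S : Fin n → Bool
  S x = does (InS? G ε a b x)
  S⊆N[a] : ∀ x → S x ≡ true → N a x ≡ true
  S⊆N[a] x x∈S = proj₁ (from-does (InS? G ε a b x) x∈S)
  ∣N[b]∣≡degree : ∣ N b ∣ ≡ degree G b
  ∣N[b]∣≡degree = sym (trans (count≡∣does∣ (inN? G b)) (sum-cong-≗ λ w → cong χ (does-≟-true (N b w))))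
    where
    does-≟-true : ∀ x → does (x Data.Bool.≟ true) ≡ x
    does-≟-true false = refl
    does-≟-true true  = refl
  misses : ∀ x → S x ≡ true → ∣ N b ∣ ≤ q * ∣ N b ∩ ∁ (N x) ∣
  misses x x∈S = subst (_≤ q * ∣ N b ∩ ∁ (N x) ∣) common+missed≡∣N[b]∣
    (≤[1-ε]*⇒≤↧ε* ε 0<ε (subst (λ d → ℕ→ℚ (commonNbrs G x b) ≤ℚ (1ℚ ℚ.- ε) *ℚ ℕ→ℚ d)
      (trans (sym ∣N[b]∣≡degree) (sym common+missed≡∣N[b]∣)) (proj₂ (from-does (InS? G ε a b x) x∈S))))
    where
    common+missed≡∣N[b]∣ : commonNbrs G x b + ∣ N b ∩ ∁ (N x) ∣ ≡ ∣ N b ∣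
    common+missed≡∣N[b]∣ = trans (cong (_+ ∣ N b ∩ ∁ (N x) ∣) (count≡∣does∣ (λ w → T? (N x w ∧ N b w))))
                                 (∣Q∩P∣+∣P∩∁Q∣≡∣P∣ (N b) (N x))
  dense : ∀ x → S x ≡ true → 2 * q * t + ∣ N b ∣ ≤ 2 * q * ∣ N b ∩ ∁ (N x) ∣
  dense x x∈S = begin
    2 * q * t + ∣ N b ∣     ≤⟨ ℕ.+-monoˡ-≤ ∣ N b ∣ 2qt≤∣N[b]∣ ⟩
    ∣ N b ∣ + ∣ N b ∣       ≤⟨ ℕ.+-mono-≤ (misses x x∈S) (misses x x∈S) ⟩
    q * missed + q * missed ≡⟨ twice q missed ⟩
    2 * q * missed          ∎
    where
    open ℕ.≤-Reasoning
    open import Data.Nat.Tactic.RingSolver using (solve-∀)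
    missed = ∣ N b ∩ ∁ (N x) ∣
    twice : ∀ u v → u * v + u * v ≡ 2 * u * v
    twice = solve-∀
    2qt≤∣N[b]∣ : 2 * q * t ≤ ∣ N b ∣
    2qt≤∣N[b]∣ = ℕ.≤-trans (ℕ.m≤n+m _ ((2 * q) ^ t * t)) (subst (C₂ t ε ≤_) (sym ∣N[b]∣≡degree) (δ≥C₂ b))
  biclique : C₂ t ε < sizeS G ε a b → Biclique (λ x → ∁ (N x)) (N a) (N b) t t
  biclique C₂<∣S∣ = record { left = Distinct-⊆ S⊆N[a] (left B) ; right = right B ; complete = complete B }
    where
    large : (2 * q) ^ t * t < ∣ S ∣
    large = ℕ.≤-<-trans (ℕ.m≤m+n _ (2 * q * t)) (subst (C₂ t ε <_) (count≡∣does∣ (InS? G ε a b)) C₂<∣S∣)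
    B : Biclique (λ x → ∁ (N x)) S (N b) t t
    B = dense⇒biclique (λ x → ∁ (N x)) (2 * q) t S (N b) dense large

lemma1p9 : Σ (ℕ → ℚ → ℕ) λ C₂ →
  ∀ (t : ℕ) (ε : ℚ) → 0ℚ <ℚ ε → ε <ℚ 1ℚ →
  ∀ (n : ℕ) (G : Graph n) (side : Fin n → Bool) →
  IsBipartition G side →
  minDegree≥ G (C₂ t ε) →
  InducedSFree t G →
  ∀ (a b : Fin n) → adj G a b ≡ true →
  sizeS G ε a b ≤ C₂ t ε
lemma1p9 = C₂ , λ t ε 0<ε _ n G side bipartite δ≥C₂ S-free a b ab →
  size-bound G bipartite t ε 0<ε δ≥C₂ S-free ab
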